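{- Let $G$ be a chordal graph on $n$ vertices with no isolated vertices. Then the noncover complex $NC(G)$ is $(n - i\gamma(G) - 1)$-collapsible.
   Context: Let $G=(V,E)$ be a finite simple graph. A set $I\subset V$ is independent if no two vertices of $I$ are adjacent. A set $W\subset V$ is a (vertex) cover of $G$ if $V\setminus W$ is independent, and a noncover if it is not a cover. The noncover complex $NC(G)$ is the simplicial complex on $V$ whose faces are the noncovers of $G$. For $W\subset V$, let $N(W)$ be the set of vertices adjacent to some vertex of $W$; $W$ dominates $A\subset V$ if $A\subset W\cup N(W)$. The independence domination number $i\gamma(G)$ is the minimum integer $k$ such that for every independent set $I$ of $G$ there is $W\subset V$ with $|W|\le k$ dominating $I$. A graph is chordal if it has no induced cycle of length at least $4$. For a simplicial complex $K$, a face $\sigma$ is free if it is contained in a unique maximal face of $K$; an elementary $d$-collapse removes a free face $\sigma$ with $|\sigma|\le d$ together with all faces containing $\sigma$; $K$ is $d$-collapsible if a finite sequence of elementary $d$-collapses turns $K$ into the void complex. -}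

module Defs where

open import Data.Nat using (ℕ; zero; suc; _≤_; _∸_)
open import Data.Bool using (Bool; true; false)
open import Data.Fin using (Fin; toℕ)
open import Data.Fin.Subset using (Subset; _∈_; _⊆_; ∁; ∣_∣)
open import Data.Product using (Σ; ∃; _×_; _,_)
open import Data.Sum using (_⊎_)
open import Data.Empty using (⊥)
open import Relation.Nullary using (¬_)
open import Relation.Binary.PropositionalEquality using (_≡_)
open import Function.Definitions using (Injective)
open import Function.Bundles using (_⇔_)
open import Level using (0ℓ)

record Graph (n : ℕ) : Set where
  field
    adj     : Fin n → Fin n → Bool
    adj-sym : ∀ u v → adj u v ≡ adj v u
    irrefl  : ∀ v → adj v v ≡ false

open Graph public

module _ {n : ℕ} (G : Graph n) where

  Adj : Fin n → Fin n → Set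
  Adj u v = adj G u v ≡ true

  Independent : Subset n → Set
  Independent I = ∀ u v → u ∈ I → v ∈ I → ¬ Adj u v

  Cover : Subset n → Set
  Cover W = Independent (∁ W)

  NonCover : Subset n → Set
  NonCover W = ¬ Cover W

  -- The noncover complex NC(G), as the predicate "is a face"
  NC : Subset n → Set
  NC = NonCover

  Dominates : Subset n → Subset n → Set
  Dominates W A = ∀ v → v ∈ A → (v ∈ W) ⊎ (Σ (Fin n) λ u → u ∈ W × Adj u v)

  IGammaBound : ℕ → Set
  IGammaBound k = ∀ I → Independent I →
    Σ (Subset n) λ W → (∣ W ∣ ≤ k) × Dominates W I

  IsIndepDomNumber : ℕ → Set
  IsIndepDomNumber k = IGammaBound k × (∀ j → IGammaBound j → k ≤ j)

  NoIsolatedVertices : Set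
  NoIsolatedVertices = ∀ v → Σ (Fin n) λ u → Adj u v

  CycAdjacent : (m : ℕ) → Fin m → Fin m → Set
  CycAdjacent m i j =
    (suc (toℕ i) ≡ toℕ j) ⊎ (suc (toℕ j) ≡ toℕ i) ⊎
    ((toℕ i ≡ 0) × (suc (toℕ j) ≡ m)) ⊎ ((toℕ j ≡ 0) × (suc (toℕ i) ≡ m))

  InducedCycle : (m : ℕ) → (Fin m → Fin n) → Set
  InducedCycle m c = Injective _≡_ _≡_ c × (∀ i j → Adj (c i) (c j) ⇔ CycAdjacent m i j)

  Chordal : Set
  Chordal = ∀ m → 4 ≤ m → (c : Fin m → Fin n) → ¬ InducedCycle m c

module _ {n : ℕ} where

  MaximalFace : (Subset n → Set) → Subset n → Set
  MaximalFace K τ = K τ × (∀ τ' → K τ' → τ ⊆ τ' → τ' ≡ τ)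

  Free : (Subset n → Set) → Subset n → Set
  Free K σ = Σ (Subset n) λ τ → MaximalFace K τ × σ ⊆ τ ×
             (∀ τ' → MaximalFace K τ' → σ ⊆ τ' → τ' ≡ τ)

  Remove : (Subset n → Set) → Subset n → (Subset n → Set)
  Remove K σ τ = K τ × ¬ (σ ⊆ τ)

  data Collapsible (d : ℕ) (K : Subset n → Set) : Set₁ where
    done : (∀ τ → ¬ K τ) → Collapsible d K
    step : (σ : Subset n) → K σ → ∣ σ ∣ ≤ d → Free K σ →
           Collapsible d (Remove K σ) → Collapsible d K

-- Induct on a vertex set A, proving that the noncover complex of the induced
-- subgraph G[A] is collapsible through faces of size < ∣A∣ − iγ(G[A]).  If G[A]
-- has no edge the complex is void.  Otherwise chordality provides an edge yx with
-- N[y] ⊆ N[x] in G[A]: else every induced path could be prolonged at one end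
-- (a neighbour that does not prolong it closes an induced cycle of length ≥ 4),
-- which is impossible in a finite graph.
-- Decompose the complex at x.  Its link at x is the noncover complex of G[A − x],
-- and iγ(G[A − x]) ≥ iγ(G[A]) since x can be traded for y in independent sets.
-- Its deletion of x consists of the sets W ⊆ A − x leaving an edge or a neighbour
-- of x uncovered; removing the neighbours of x one at a time costs one dimension
-- each and leaves the noncover complex of G[A − N[x]], while
-- iγ(G[A]) ≤ iγ(G[A − N[x]]) + 1.
module Submission where

open import Data.Bool using (true)
import Data.Bool
open import Data.Fin using (Fin; _≟_; toℕ)
open import Data.Fin.Properties using (any?; all?; ¬∀⟶∃¬; pigeonhole; toℕ<n; toℕ-injective)
open import Data.Fin.Subset
open import Data.Fin.Subset.Properties
open import Data.Nat using (ℕ; zero; suc; _+_; _∸_; _≤_; _<_; z≤n; s≤s; _≤?_)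
open import Data.Nat.Induction using (<-wellFounded)
open import Data.Nat.Properties
  using (≤-refl; ≤-reflexive; ≤-trans; ≤-pred; ≤-<-trans; <-≤-trans; <-irrefl; ≮⇒≥; 1+n≰n;
         n≤1+n; m<n⇒m<1+n; m<1+n⇒m<n∨m≡n; +-suc; +-comm; +-monoʳ-≤; +-monoˡ-≤;
         +-cancelʳ-≤; ∸-monoˡ-≤; m+n∸m≡n; +-∸-assoc; m+[n∸m]≡n; m≤n+m∸n)
open import Data.Product using (∃; ∃₂; _×_; _,_; proj₁; proj₂)
open import Data.Sum using (_⊎_; inj₁; inj₂; map; map₂; [_,_])
open import Data.Vec using (_∷_; []; tabulate)
open import Data.Vec.Base using (_[_]=_)
open import Data.Vec.Properties using (lookup∘tabulate; lookup⇒[]=; []=⇒lookup)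
open import Function using (_∘_)
open import Function.Bundles using (_⇔_; mk⇔; Equivalence)
open import Induction.WellFounded using (Acc; acc)
open import Level using (0ℓ)
open import Relation.Binary.PropositionalEquality
  using (_≡_; _≢_; refl; sym; trans; cong; subst; subst₂; module ≡-Reasoning)
open import Relation.Nullary using (¬_; contradiction; Dec; yes; no)
open import Relation.Nullary.Decidable using (_×-dec_; _⊎-dec_; _→-dec_)
open import Relation.Unary using (Pred; _≐_)
open import Relation.Unary.Properties using (≐-sym; ≐-trans)

open import Defs

open _[_]=_
open ≡-Reasoning

private
  variable
    n : ℕ
    x y : Fin n
    p q r : Subset n

-- Finite sets

x∈p─q⇒x∉q : x ∈ p ─ q → x ∉ q
x∈p─q⇒x∉q {p = _ ∷ _} {q = outside ∷ _} here ()
x∈p─q⇒x∉q {p = _ ∷ _} {q = inside ∷ _} (there x∈) (there x∈q) = x∈p─q⇒x∉q x∈ x∈q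
x∈p─q⇒x∉q {p = _ ∷ _} {q = outside ∷ _} (there x∈) (there x∈q) = x∈p─q⇒x∉q x∈ x∈q

x∉p-x : x ∉ p - x
x∉p-x {x = x} x∈ = x∈p─q⇒x∉q x∈ (x∈⁅x⁆ x)

∣p∪q∣≤∣p∣+∣q∣ : ∀ (p q : Subset n) → ∣ p ∪ q ∣ ≤ ∣ p ∣ + ∣ q ∣
∣p∪q∣≤∣p∣+∣q∣ [] [] = z≤n
∣p∪q∣≤∣p∣+∣q∣ (inside ∷ p) (inside ∷ q) =
  s≤s (≤-trans (∣p∪q∣≤∣p∣+∣q∣ p q) (+-monoʳ-≤ ∣ p ∣ (n≤1+n ∣ q ∣)))
∣p∪q∣≤∣p∣+∣q∣ (inside ∷ p) (outside ∷ q) = s≤s (∣p∪q∣≤∣p∣+∣q∣ p q)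
∣p∪q∣≤∣p∣+∣q∣ (outside ∷ p) (inside ∷ q) =
  ≤-trans (s≤s (∣p∪q∣≤∣p∣+∣q∣ p q)) (≤-reflexive (sym (+-suc ∣ p ∣ ∣ q ∣)))
∣p∪q∣≤∣p∣+∣q∣ (outside ∷ p) (outside ∷ q) = ∣p∪q∣≤∣p∣+∣q∣ p q

∣p∣≡∣q∣+∣p─q∣ : ∀ (p q : Subset n) → q ⊆ p → ∣ p ∣ ≡ ∣ q ∣ + ∣ p ─ q ∣
∣p∣≡∣q∣+∣p─q∣ [] [] _ = refl
∣p∣≡∣q∣+∣p─q∣ (inside ∷ p) (inside ∷ q) q⊆p = cong suc (∣p∣≡∣q∣+∣p─q∣ p q (drop-∷-⊆ q⊆p))
∣p∣≡∣q∣+∣p─q∣ (inside ∷ p) (outside ∷ q) q⊆p =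
  trans (cong suc (∣p∣≡∣q∣+∣p─q∣ p q (drop-∷-⊆ q⊆p))) (sym (+-suc ∣ q ∣ ∣ p ─ q ∣))
∣p∣≡∣q∣+∣p─q∣ (outside ∷ p) (inside ∷ q) q⊆p = contradiction (q⊆p here) λ ()
∣p∣≡∣q∣+∣p─q∣ (outside ∷ p) (outside ∷ q) q⊆p = ∣p∣≡∣q∣+∣p─q∣ p q (drop-∷-⊆ q⊆p)

x∈p-y⇒x≢y : x ∈ p - y → x ≢ y
x∈p-y⇒x≢y x∈ refl = x∉p-x x∈

x∈p⇒⁅x⁆⊆p : x ∈ p → ⁅ x ⁆ ⊆ p
x∈p⇒⁅x⁆⊆p {x = x} {p} x∈p y∈ = subst (_∈ p) (sym (x∈⁅y⁆⇒x≡y x y∈)) x∈p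

x∈p⇒∣p∣≡1+∣p-x∣ : x ∈ p → ∣ p ∣ ≡ suc ∣ p - x ∣
x∈p⇒∣p∣≡1+∣p-x∣ {x = x} {p} x∈p =
  trans (∣p∣≡∣q∣+∣p─q∣ p ⁅ x ⁆ (x∈p⇒⁅x⁆⊆p x∈p)) (cong (_+ ∣ p - x ∣) (∣⁅x⁆∣≡1 x))

x∈p∪⁅y⁆⁻ : x ∈ p ∪ ⁅ y ⁆ → x ∈ p ⊎ x ≡ y
x∈p∪⁅y⁆⁻ {p = p} {y} x∈ = map₂ (x∈⁅y⁆⇒x≡y y) (x∈p∪q⁻ p ⁅ y ⁆ x∈)

y∈p∪⁅y⁆ : y ∈ p ∪ ⁅ y ⁆
y∈p∪⁅y⁆ {y = y} = x∈p∪q⁺ (inj₂ (x∈⁅x⁆ y))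

x∉p⇒p∪⁅x⁆-x≡p : x ∉ p → p ∪ ⁅ x ⁆ - x ≡ p
x∉p⇒p∪⁅x⁆-x≡p {x = x} {p} x∉p =
  ⊆-antisym ⊆p (λ y∈p → x∈p∧x≢y⇒x∈p-y (p⊆p∪q ⁅ x ⁆ y∈p) λ { refl → x∉p y∈p })
  where
  ⊆p : p ∪ ⁅ x ⁆ - x ⊆ p
  ⊆p y∈ with x∈p∪⁅y⁆⁻ (p─q⊆p _ _ y∈)
  ... | inj₁ y∈p = y∈p
  ... | inj₂ refl = contradiction y∈ x∉p-x

x∈p⇒p-x∪⁅x⁆≡p : x ∈ p → (p - x) ∪ ⁅ x ⁆ ≡ p
x∈p⇒p-x∪⁅x⁆≡p {x = x} {p} x∈p = ⊆-antisym ⊆p ⊇p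
  where
  ⊆p : (p - x) ∪ ⁅ x ⁆ ⊆ p
  ⊆p y∈ with x∈p∪⁅y⁆⁻ y∈
  ... | inj₁ y∈p-x = p─q⊆p _ _ y∈p-x
  ... | inj₂ refl = x∈p
  ⊇p : p ⊆ (p - x) ∪ ⁅ x ⁆
  ⊇p {y} y∈p with y ≟ x
  ... | yes refl = y∈p∪⁅y⁆
  ... | no y≢x = p⊆p∪q ⁅ x ⁆ (x∈p∧x≢y⇒x∈p-y y∈p y≢x)

⊥─p≡⊥ : ∀ (p : Subset n) → ⊥ ─ p ≡ ⊥
⊥─p≡⊥ p = ⊆-antisym (p─q⊆p ⊥ p) ⊥⊆

p-x─q≡p─q∪⁅x⁆ : ∀ (p q : Subset n) x → p - x ─ q ≡ p ─ (q ∪ ⁅ x ⁆)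
p-x─q≡p─q∪⁅x⁆ p q x = trans (p─q─r≡p─q∪r p ⁅ x ⁆ q) (cong (p ─_) (∪-comm ⁅ x ⁆ q))

x∈q⇒p-x─[q-x]≡p─q : ∀ (p q : Subset n) → x ∈ q → p - x ─ (q - x) ≡ p ─ q
x∈q⇒p-x─[q-x]≡p─q p q x∈q = trans (p-x─q≡p─q∪⁅x⁆ p _ _) (cong (p ─_) (x∈p⇒p-x∪⁅x⁆≡p x∈q))

∪-monoˡ-⊆ : p ⊆ q → p ∪ r ⊆ q ∪ r
∪-monoˡ-⊆ {p = p} {q} {r} p⊆q x∈ with x∈p∪q⁻ p r x∈
... | inj₁ x∈p = p⊆p∪q r (p⊆q x∈p)
... | inj₂ x∈r = q⊆p∪q q r x∈r

∣p∪⁅x⁆∣≤1+∣p∣ : ∣ p ∪ ⁅ x ⁆ ∣ ≤ suc ∣ p ∣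
∣p∪⁅x⁆∣≤1+∣p∣ {p = p} {x} =
  ≤-trans (∣p∪q∣≤∣p∣+∣q∣ p ⁅ x ⁆)
          (≤-reflexive (trans (cong (∣ p ∣ +_) (∣⁅x⁆∣≡1 x)) (+-comm ∣ p ∣ 1)))

p⊆q⇒p⊆q-x : x ∉ p → p ⊆ q → p ⊆ q - x
p⊆q⇒p⊆q-x x∉p p⊆q y∈p = x∈p∧x≢y⇒x∈p-y (p⊆q y∈p) λ { refl → x∉p y∈p }

p⊆q-x⇒x∉p : p ⊆ q - x → x ∉ p
p⊆q-x⇒x∉p p⊆q-x x∈p = x∉p-x (p⊆q-x x∈p)

p∪⁅x⁆⊆q⇒p⊆q-x : x ∉ p → p ∪ ⁅ x ⁆ ⊆ q → p ⊆ q - x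
p∪⁅x⁆⊆q⇒p⊆q-x x∉p px⊆q = p⊆q⇒p⊆q-x x∉p (px⊆q ∘ p⊆p∪q _)

p⊆q-x⇒p∪⁅x⁆⊆q : x ∈ q → p ⊆ q - x → p ∪ ⁅ x ⁆ ⊆ q
p⊆q-x⇒p∪⁅x⁆⊆q x∈q p⊆q-x y∈ with x∈p∪⁅y⁆⁻ y∈
... | inj₁ y∈p = p─q⊆p _ _ (p⊆q-x y∈p)
... | inj₂ refl = x∈q

─-monoˡ-⊆ : p ⊆ q → p ─ r ⊆ q ─ r
─-monoˡ-⊆ p⊆q x∈ = x∈p∧x∉q⇒x∈p─q (p⊆q (p─q⊆p _ _ x∈)) (x∈p─q⇒x∉q x∈)

p∪⁅x⁆⊆q∪⁅x⁆⇒p⊆q : x ∉ p → p ∪ ⁅ x ⁆ ⊆ q ∪ ⁅ x ⁆ → p ⊆ q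
p∪⁅x⁆⊆q∪⁅x⁆⇒p⊆q {q = q} x∉p px⊆qx y∈p with x∈p∪⁅y⁆⁻ (px⊆qx (p⊆p∪q _ y∈p))
... | inj₁ y∈q = y∈q
... | inj₂ refl = contradiction y∈p x∉p

-- Collapsibility

Complex : ℕ → Set₁
Complex n = Pred (Subset n) 0ℓ

private
  variable
    K L : Complex n
    σ τ ρ : Subset n
    d e : ℕ

link : Complex n → Fin n → Complex n
link K x τ = x ∉ τ × K (τ ∪ ⁅ x ⁆)

deletion : Complex n → Fin n → Complex n
deletion K x τ = x ∉ τ × K τ

-- The strict bound ∣ σ ∣ < d makes a vertex decomposition raise the bound by
-- exactly one, also when the link is void.
data CollapsibleBelow (d : ℕ) (K : Complex n) : Set₁ where
  done : (∀ τ → ¬ K τ) → CollapsibleBelow d K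
  step : ∀ σ → K σ → ∣ σ ∣ < d → Free K σ →
         CollapsibleBelow d (Remove K σ) → CollapsibleBelow d K

collapsibleBelow⇒collapsible : CollapsibleBelow d K → Collapsible (d ∸ 1) K
collapsibleBelow⇒collapsible (done void) = done void
collapsibleBelow⇒collapsible {d = suc d} (step σ kσ (s≤s ∣σ∣≤d) free c) =
  step σ kσ ∣σ∣≤d free (collapsibleBelow⇒collapsible c)

CollapsibleBelow-mono : ∀ {d d'} → d ≤ d' → CollapsibleBelow d K → CollapsibleBelow d' K
CollapsibleBelow-mono d≤d' (done void) = done void
CollapsibleBelow-mono d≤d' (step σ kσ ∣σ∣<d free c) =
  step σ kσ (≤-trans ∣σ∣<d d≤d') free (CollapsibleBelow-mono d≤d' c)

MaximalFace-resp-≐ : K ≐ L → MaximalFace K τ → MaximalFace L τ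
MaximalFace-resp-≐ (K⊆L , L⊆K) (kτ , maximal) = K⊆L kτ , λ τ' lτ' → maximal τ' (L⊆K lτ')

Free-resp-≐ : K ≐ L → Free K σ → Free L σ
Free-resp-≐ K≐L (τ , maxτ , σ⊆τ , unique) =
  τ , MaximalFace-resp-≐ K≐L maxτ , σ⊆τ ,
  λ τ' maxτ' → unique τ' (MaximalFace-resp-≐ (≐-sym K≐L) maxτ')

Remove-resp-≐ : K ≐ L → Remove K σ ≐ Remove L σ
Remove-resp-≐ (K⊆L , L⊆K) = (λ (kτ , σ⊈τ) → K⊆L kτ , σ⊈τ) , (λ (lτ , σ⊈τ) → L⊆K lτ , σ⊈τ)

CollapsibleBelow-resp-≐ : K ≐ L → CollapsibleBelow d K → CollapsibleBelow d L
CollapsibleBelow-resp-≐ (_ , L⊆K) (done void) = done λ τ lτ → void τ (L⊆K lτ)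
CollapsibleBelow-resp-≐ K≐L (step σ kσ ∣σ∣<d free c) =
  step σ (proj₁ K≐L kσ) ∣σ∣<d (Free-resp-≐ K≐L free)
       (CollapsibleBelow-resp-≐ (Remove-resp-≐ K≐L) c)

simplex-collapsibleBelow : ∀ (B : Subset n) → CollapsibleBelow 1 (_⊆ B)
simplex-collapsibleBelow {n} B =
  step ⊥ ⊥⊆ (s≤s (≤-reflexive (∣⊥∣≡0 n))) (B , maxB , ⊥⊆ , unique)
       (done λ τ (_ , ⊥⊈τ) → ⊥⊈τ ⊥⊆)
  where
  maxB : MaximalFace (_⊆ B) B
  maxB = ⊆-refl , λ τ τ⊆B B⊆τ → ⊆-antisym τ⊆B B⊆τ
  unique : ∀ τ → MaximalFace (_⊆ B) τ → ⊥ ⊆ τ → τ ≡ B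
  unique τ (τ⊆B , maximal) _ = sym (maximal B ⊆-refl τ⊆B)

module _ {K : Complex n} {x : Fin n} where

  link-∋ : x ∈ ρ → K ρ → link K x (ρ - x)
  link-∋ x∈ρ kρ = x∉p-x , subst K (sym (x∈p⇒p-x∪⁅x⁆≡p x∈ρ)) kρ

  link-void⇒deletion≐ : (∀ τ → ¬ link K x τ) → deletion K x ≐ K
  link-void⇒deletion≐ void = proj₂ , λ {τ} kτ → x∉τ kτ , kτ
    where
    x∉τ : K τ → x ∉ τ
    x∉τ {τ} kτ x∈τ = void (τ - x) (link-∋ x∈τ kτ)

  maximal-link⇒maximal : MaximalFace (link K x) τ → MaximalFace K (τ ∪ ⁅ x ⁆)
  maximal-link⇒maximal {τ} ((x∉τ , kτx) , maximal) = kτx , λ ρ kρ τx⊆ρ →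
    let x∈ρ = τx⊆ρ y∈p∪⁅y⁆ in
    begin
      ρ                ≡⟨ x∈p⇒p-x∪⁅x⁆≡p x∈ρ ⟨
      (ρ - x) ∪ ⁅ x ⁆  ≡⟨ cong (_∪ ⁅ x ⁆)
                            (maximal (ρ - x) (link-∋ x∈ρ kρ) (p∪⁅x⁆⊆q⇒p⊆q-x x∉τ τx⊆ρ)) ⟩
      τ ∪ ⁅ x ⁆        ∎

  maximal⇒maximal-link : x ∈ ρ → MaximalFace K ρ → MaximalFace (link K x) (ρ - x)
  maximal⇒maximal-link {ρ} x∈ρ (kρ , maximal) = link-∋ x∈ρ kρ , λ μ (x∉μ , kμx) ρ-x⊆μ →
    begin
      μ                    ≡⟨ x∉p⇒p∪⁅x⁆-x≡p x∉μ ⟨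
      μ ∪ ⁅ x ⁆ - x        ≡⟨ cong (_- x) (maximal (μ ∪ ⁅ x ⁆) kμx (ρ⊆μx ρ-x⊆μ)) ⟩
      ρ - x                ∎
    where
    ρ⊆μx : ∀ {μ} → ρ - x ⊆ μ → ρ ⊆ μ ∪ ⁅ x ⁆
    ρ⊆μx ρ-x⊆μ = subst (_⊆ _) (x∈p⇒p-x∪⁅x⁆≡p x∈ρ) (∪-monoˡ-⊆ ρ-x⊆μ)

  free-link⇒free : Free (link K x) σ → Free K (σ ∪ ⁅ x ⁆)
  free-link⇒free {σ} (τ , maxτ , σ⊆τ , unique) =
    τ ∪ ⁅ x ⁆ , maximal-link⇒maximal maxτ , ∪-monoˡ-⊆ σ⊆τ , λ ρ maxρ σx⊆ρ →
    let x∈ρ = σx⊆ρ y∈p∪⁅y⁆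
        x∉σ = λ x∈σ → proj₁ (proj₁ maxτ) (σ⊆τ x∈σ)
    in begin
      ρ                ≡⟨ x∈p⇒p-x∪⁅x⁆≡p x∈ρ ⟨
      (ρ - x) ∪ ⁅ x ⁆  ≡⟨ cong (_∪ ⁅ x ⁆)
                            (unique (ρ - x) (maximal⇒maximal-link x∈ρ maxρ) (p∪⁅x⁆⊆q⇒p⊆q-x x∉σ σx⊆ρ)) ⟩
      τ ∪ ⁅ x ⁆        ∎

  link-Remove : x ∉ σ → link (Remove K (σ ∪ ⁅ x ⁆)) x ≐ Remove (link K x) σ
  link-Remove x∉σ =
    (λ (x∉τ , kτx , σx⊈τx) → (x∉τ , kτx) , λ σ⊆τ → σx⊈τx (∪-monoˡ-⊆ σ⊆τ)) ,
    (λ ((x∉τ , kτx) , σ⊈τ) → x∉τ , kτx , λ σx⊆τx → σ⊈τ (p∪⁅x⁆⊆q∪⁅x⁆⇒p⊆q x∉σ σx⊆τx))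

  deletion-Remove : x ∈ σ → deletion (Remove K σ) x ≐ deletion K x
  deletion-Remove x∈σ =
    (λ (x∉τ , kτ , _) → x∉τ , kτ) , (λ (x∉τ , kτ) → x∉τ , kτ , λ σ⊆τ → x∉τ (σ⊆τ x∈σ))

-- Each collapse in the link lifts to the collapse of σ ∪ ⁅ x ⁆ in K; once the
-- link is void, K is its deletion.
collapsibleBelow-vertexDecomposition : ∀ (K : Complex n) x → CollapsibleBelow e L → link K x ≐ L →
  CollapsibleBelow (suc e) (deletion K x) → CollapsibleBelow (suc e) K
collapsibleBelow-vertexDecomposition K x (done void) link≐L cdel =
  CollapsibleBelow-resp-≐ (link-void⇒deletion≐ {K = K} λ τ lτ → void τ (proj₁ link≐L lτ)) cdel
collapsibleBelow-vertexDecomposition K x (step σ lσ ∣σ∣<e free c) link≐L cdel =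
  step (σ ∪ ⁅ x ⁆) kσx (s≤s (≤-trans (∣p∪⁅x⁆∣≤1+∣p∣ {p = σ}) ∣σ∣<e))
    (free-link⇒free {K = K} (Free-resp-≐ (≐-sym link≐L) free))
    (collapsibleBelow-vertexDecomposition (Remove K (σ ∪ ⁅ x ⁆)) x c
      (≐-trans (link-Remove {K = K} x∉σ) (Remove-resp-≐ link≐L))
      (CollapsibleBelow-resp-≐ (≐-sym (deletion-Remove {K = K} y∈p∪⁅y⁆)) cdel))
  where
  x∉σ = proj₁ (proj₂ link≐L lσ)
  kσx = proj₂ (proj₂ link≐L lσ)

_◂_ : {X : Set} → X → (ℕ → X) → ℕ → X
(z ◂ p) zero = z
(z ◂ p) (suc i) = p i

firstBelow : (P : ℕ → Set) → (∀ k → Dec (P k)) → ∀ b →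
  (∀ {k} → k < b → ¬ P k) ⊎ ∃ λ j → j < b × P j × (∀ {k} → k < j → ¬ P k)
firstBelow P P? zero = inj₁ λ ()
firstBelow P P? (suc b) with firstBelow P P? b
... | inj₂ (j , j<b , pj , below) = inj₂ (j , m<n⇒m<1+n j<b , pj , below)
... | inj₁ none with P? b
...   | yes pb = inj₂ (b , ≤-refl , pb , none)
...   | no ¬pb = inj₁ λ k<1+b → [ none , (λ { refl → ¬pb }) ] (m<1+n⇒m<n∨m≡n k<1+b)

module _ {n : ℕ} (G : Graph n) where

  private
    variable
      u v w z : Fin n
      A S I W : Subset n

  adj? : ∀ u v → Dec (Adj G u v)
  adj? u v = adj G u v Data.Bool.≟ true

  Adj-sym : Adj G u v → Adj G v u
  Adj-sym {u} {v} uv = trans (adj-sym G v u) uv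

  Adj-irrefl : ¬ Adj G v v
  Adj-irrefl {v} vv with trans (sym vv) (irrefl G v)
  ... | ()

  Adj⇒≢ : Adj G u v → u ≢ v
  Adj⇒≢ uv refl = Adj-irrefl uv

  nbhd : Subset n → Fin n → Subset n
  nbhd A x = A ∩ tabulate (adj G x)

  ∈nbhd⁺ : u ∈ A → Adj G x u → u ∈ nbhd A x
  ∈nbhd⁺ {u} {x = x} u∈A xu = x∈p∩q⁺ (u∈A , lookup⇒[]= u _ (trans (lookup∘tabulate (adj G x) u) xu))

  ∈nbhd⁻ : u ∈ nbhd A x → u ∈ A × Adj G x u
  ∈nbhd⁻ {u} {A} {x} u∈ =
    let u∈A , u∈adj = x∈p∩q⁻ A _ u∈ in u∈A , trans (sym (lookup∘tabulate (adj G x) u)) ([]=⇒lookup u∈adj)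

  nbhd⊆-x : nbhd A x ⊆ A - x
  nbhd⊆-x u∈ = let u∈A , xu = ∈nbhd⁻ u∈ in x∈p∧x≢y⇒x∈p-y u∈A (Adj⇒≢ xu ∘ sym)

  HasEdge : Subset n → Set
  HasEdge B = ∃₂ λ u v → u ∈ B × v ∈ B × Adj G u v

  hasEdge? : ∀ B → Dec (HasEdge B)
  hasEdge? B = any? λ u → any? λ v → u ∈? B ×-dec v ∈? B ×-dec adj? u v

  HasEdge-mono : A ⊆ S → HasEdge A → HasEdge S
  HasEdge-mono A⊆S (u , v , u∈ , v∈ , uv) = u , v , A⊆S u∈ , A⊆S v∈ , uv

  -- Noncover complexes of induced subgraphs

  -- NC[ A , ⊥ ] is the noncover complex of the induced subgraph G[A];
  -- NC[ A , S ] adds every subset of A that misses a vertex of S.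
  NC[_,_] : Subset n → Subset n → Complex n
  NC[ A , S ] W = W ⊆ A × (Nonempty (S ─ W) ⊎ HasEdge (A ─ W))

  link-NC : x ∈ A → link NC[ A , S ] x ≐ NC[ A - x , S - x ]
  link-NC {x} {A} {S} x∈A =
    (λ (x∉τ , τx⊆A , r) → p∪⁅x⁆⊆q⇒p⊆q-x x∉τ τx⊆A , subst₂ Uncovered (sym eqS) (sym eqA) r) ,
    (λ (τ⊆A-x , r) → p⊆q-x⇒x∉p τ⊆A-x , p⊆q-x⇒p∪⁅x⁆⊆q x∈A τ⊆A-x , subst₂ Uncovered eqS eqA r)
    where
    Uncovered : Subset n → Subset n → Set
    Uncovered S' A' = Nonempty S' ⊎ HasEdge A'
    eqS : ∀ {τ} → S - x ─ τ ≡ S ─ (τ ∪ ⁅ x ⁆)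
    eqS = p-x─q≡p─q∪⁅x⁆ S _ x
    eqA : ∀ {τ} → A - x ─ τ ≡ A ─ (τ ∪ ⁅ x ⁆)
    eqA = p-x─q≡p─q∪⁅x⁆ A _ x

  deletion-NC-∈ : x ∈ S → deletion NC[ A , S ] x ≐ (_⊆ A - x)
  deletion-NC-∈ x∈S =
    (λ (x∉τ , τ⊆A , _) → p⊆q⇒p⊆q-x x∉τ τ⊆A) ,
    (λ τ⊆A-x → let x∉τ = p⊆q-x⇒x∉p τ⊆A-x in
               x∉τ , p─q⊆p _ _ ∘ τ⊆A-x , inj₁ (_ , x∈p∧x∉q⇒x∈p─q x∈S x∉τ))

  deletion-NC-⊥ : x ∈ A → deletion NC[ A , ⊥ ] x ≐ NC[ A - x , nbhd A x ]
  deletion-NC-⊥ {x} {A} x∈A = to , from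
    where
    to : ∀ {τ} → deletion NC[ A , ⊥ ] x τ → NC[ A - x , nbhd A x ] τ
    to (x∉τ , τ⊆A , inj₁ (_ , s∈⊥─τ)) = contradiction (p─q⊆p ⊥ _ s∈⊥─τ) ∉⊥
    to {τ} (x∉τ , τ⊆A , inj₂ (u , v , u∈ , v∈ , uv)) = p⊆q⇒p⊆q-x x∉τ τ⊆A , edge (u ≟ x) (v ≟ x)
      where
      ∈nbhd─τ : Adj G x w → w ∈ A ─ τ → w ∈ nbhd A x ─ τ
      ∈nbhd─τ xw w∈ = x∈p∧x∉q⇒x∈p─q (∈nbhd⁺ (p─q⊆p _ _ w∈) xw) (x∈p─q⇒x∉q w∈)
      ∈A-x─τ : w ≢ x → w ∈ A ─ τ → w ∈ A - x ─ τ
      ∈A-x─τ w≢x w∈ = x∈p∧x∉q⇒x∈p─q (x∈p∧x≢y⇒x∈p-y (p─q⊆p _ _ w∈) w≢x) (x∈p─q⇒x∉q w∈)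
      edge : Dec (u ≡ x) → Dec (v ≡ x) → Nonempty (nbhd A x ─ τ) ⊎ HasEdge (A - x ─ τ)
      edge (yes refl) _ = inj₁ (v , ∈nbhd─τ uv v∈)
      edge (no _) (yes refl) = inj₁ (u , ∈nbhd─τ (Adj-sym uv) u∈)
      edge (no u≢x) (no v≢x) = inj₂ (u , v , ∈A-x─τ u≢x u∈ , ∈A-x─τ v≢x v∈ , uv)
    from : ∀ {τ} → NC[ A - x , nbhd A x ] τ → deletion NC[ A , ⊥ ] x τ
    from (τ⊆A-x , r) = x∉τ , p─q⊆p _ _ ∘ τ⊆A-x , inj₂ (edge r)
      where
      x∉τ = p⊆q-x⇒x∉p τ⊆A-x
      edge : _ → HasEdge (A ─ _)
      edge (inj₁ (w , w∈)) = let w∈A , xw = ∈nbhd⁻ (p─q⊆p _ _ w∈) in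
        x , w , x∈p∧x∉q⇒x∈p─q x∈A x∉τ , x∈p∧x∉q⇒x∈p─q w∈A (x∈p─q⇒x∉q w∈) , xw
      edge (inj₂ e) = HasEdge-mono (─-monoˡ-⊆ (p─q⊆p A ⁅ x ⁆)) e

  NC-peel : ∀ {m} → S ⊆ A → CollapsibleBelow m NC[ A ─ S , ⊥ ] → CollapsibleBelow (∣ S ∣ + m) NC[ A , S ]
  NC-peel {S} = go (<-wellFounded ∣ S ∣)
    where
    go : ∀ {S A m} → Acc _<_ ∣ S ∣ → S ⊆ A → CollapsibleBelow m NC[ A ─ S , ⊥ ] →
         CollapsibleBelow (∣ S ∣ + m) NC[ A , S ]
    go {S} {A} {m} (acc smaller) S⊆A c with nonempty? S
    ... | no ∅ with refl ← Empty-unique ∅ =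
      subst₂ (λ d B → CollapsibleBelow d NC[ B , ⊥ ]) (sym (cong (_+ m) (∣⊥∣≡0 n))) (p─⊥≡p A) c
    ... | yes (s , s∈S) =
      subst (λ d → CollapsibleBelow d NC[ A , S ]) (sym (cong (_+ m) (x∈p⇒∣p∣≡1+∣p-x∣ s∈S)))
        (collapsibleBelow-vertexDecomposition NC[ A , S ] s
          (go (smaller (x∈p⇒∣p-x∣<∣p∣ s∈S)) (─-monoˡ-⊆ S⊆A)
              (subst (λ B → CollapsibleBelow m NC[ B , ⊥ ]) (sym (x∈q⇒p-x─[q-x]≡p─q A S s∈S)) c))
          (link-NC (S⊆A s∈S))
          (CollapsibleBelow-resp-≐ (≐-sym (deletion-NC-∈ s∈S))
            (CollapsibleBelow-mono (s≤s z≤n) (simplex-collapsibleBelow (A - s)))))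

  -- Independence domination in induced subgraphs

  IGammaBoundIn : Subset n → ℕ → Set
  IGammaBoundIn A k = ∀ I → I ⊆ A → Independent G I →
    ∃ λ W → W ⊆ A × ∣ W ∣ ≤ k × Dominates G W I

  DominatedBy : Subset n → Fin n → Fin n → Set
  DominatedBy A y x = ∀ z → z ∈ A → Adj G y z → z ≡ x ⊎ Adj G x z

  module _ {A : Subset n} {x y : Fin n} (y∈A : y ∈ A) (yx : Adj G y x) (y≼x : DominatedBy A y x) where

    ¬Adj-I-x : I ⊆ A → Independent G I → x ∈ I → w ∈ I - x → ¬ Adj G y w
    ¬Adj-I-x I⊆A indI x∈I w∈ yw with y≼x _ (I⊆A (p─q⊆p _ _ w∈)) yw
    ... | inj₁ refl = x∉p-x w∈
    ... | inj₂ xw = indI x _ x∈I (p─q⊆p _ _ w∈) xw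

    independent-swap : I ⊆ A → Independent G I → x ∈ I → Independent G ((I - x) ∪ ⁅ y ⁆)
    independent-swap I⊆A indI x∈I u v u∈ v∈ with x∈p∪⁅y⁆⁻ u∈ | x∈p∪⁅y⁆⁻ v∈
    ... | inj₁ u∈I-x | inj₁ v∈I-x = indI u v (p─q⊆p _ _ u∈I-x) (p─q⊆p _ _ v∈I-x)
    ... | inj₁ u∈I-x | inj₂ refl = ¬Adj-I-x I⊆A indI x∈I u∈I-x ∘ Adj-sym
    ... | inj₂ refl | inj₁ v∈I-x = ¬Adj-I-x I⊆A indI x∈I v∈I-x
    ... | inj₂ refl | inj₂ refl = Adj-irrefl

    dominates-unswap : W ⊆ A - x → Dominates G W ((I - x) ∪ ⁅ y ⁆) → Dominates G W I
    dominates-unswap {W} {I} W⊆A-x dom v v∈I with v ≟ x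
    ... | no v≢x = dom v (p⊆p∪q _ (x∈p∧x≢y⇒x∈p-y v∈I v≢x))
    ... | yes refl with dom y y∈p∪⁅y⁆
    ...   | inj₁ y∈W = inj₂ (y , y∈W , yx)
    ...   | inj₂ (u , u∈W , uy) with y≼x u (p─q⊆p _ _ (W⊆A-x u∈W)) (Adj-sym uy)
    ...     | inj₁ refl = contradiction (W⊆A-x u∈W) x∉p-x
    ...     | inj₂ xu = inj₂ (u , u∈W , Adj-sym xu)

    IGammaBoundIn-remove-dominating : ∀ {k} → IGammaBoundIn (A - x) k → IGammaBoundIn A k
    IGammaBoundIn-remove-dominating bound I I⊆A indI with x ∈? I
    ... | no x∉I =
      let W , W⊆ , ∣W∣≤k , dom = bound I (p⊆q⇒p⊆q-x x∉I I⊆A) indI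
      in W , p─q⊆p _ _ ∘ W⊆ , ∣W∣≤k , dom
    ... | yes x∈I =
      let W , W⊆ , ∣W∣≤k , dom = bound ((I - x) ∪ ⁅ y ⁆) I'⊆A-x (independent-swap I⊆A indI x∈I)
      in W , p─q⊆p _ _ ∘ W⊆ , ∣W∣≤k , dominates-unswap W⊆ dom
      where
      I'⊆A-x : (I - x) ∪ ⁅ y ⁆ ⊆ A - x
      I'⊆A-x w∈ with x∈p∪⁅y⁆⁻ w∈
      ... | inj₁ w∈I-x = ─-monoˡ-⊆ I⊆A w∈I-x
      ... | inj₂ refl = x∈p∧x≢y⇒x∈p-y y∈A (Adj⇒≢ yx)

  IGammaBoundIn-closedNeighbourhood : ∀ {k} → x ∈ A → IGammaBoundIn (A - x ─ nbhd A x) k →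
                                      IGammaBoundIn A (suc k)
  IGammaBoundIn-closedNeighbourhood {x} {A} x∈A bound I I⊆A indI
    with bound (I ∩ (A - x ─ nbhd A x)) (p∩q⊆q _ _) (λ u v u∈ v∈ → indI u v (p∩q⊆p _ _ u∈) (p∩q⊆p _ _ v∈))
  ... | W , W⊆ , ∣W∣≤k , domW =
    W ∪ ⁅ x ⁆ , p⊆q-x⇒p∪⁅x⁆⊆q x∈A (p─q⊆p _ _ ∘ W⊆) ,
    ≤-trans (∣p∪⁅x⁆∣≤1+∣p∣ {p = W}) (s≤s ∣W∣≤k) , dom
    where
    dom : Dominates G (W ∪ ⁅ x ⁆) I
    dom v v∈I with v ≟ x | v ∈? nbhd A x
    ... | yes refl | _ = inj₁ y∈p∪⁅y⁆
    ... | no _ | yes v∈N = inj₂ (x , y∈p∪⁅y⁆ , proj₂ (∈nbhd⁻ v∈N))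
    ... | no v≢x | no v∉N
      with domW v (x∈p∩q⁺ (v∈I , x∈p∧x∉q⇒x∈p─q (x∈p∧x≢y⇒x∈p-y (I⊆A v∈I) v≢x) v∉N))
    ...   | inj₁ v∈W = inj₁ (p⊆p∪q _ v∈W)
    ...   | inj₂ (u , u∈W , uv) = inj₂ (u , p⊆p∪q _ u∈W , uv)

  IGammaBoundIn-nonNeighbours : x ∈ A → IGammaBoundIn A ∣ A ─ nbhd A x ∣
  IGammaBoundIn-nonNeighbours {x} {A} x∈A I I⊆A _ = A ─ nbhd A x , p─q⊆p _ _ , ≤-refl , dom
    where
    dom : Dominates G (A ─ nbhd A x) I
    dom v v∈I with v ∈? nbhd A x
    ... | yes v∈N = inj₂ (x , x∈p∧x∉q⇒x∈p─q x∈A (Adj-irrefl ∘ proj₂ ∘ ∈nbhd⁻) , proj₂ (∈nbhd⁻ v∈N))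
    ... | no v∉N = inj₁ (x∈p∧x∉q⇒x∈p─q (I⊆A v∈I) v∉N)

  -- ∣ A ∣ − iγ(G[A]) ≤ D
  GapAtMost : Subset n → ℕ → Set
  GapAtMost A D = ∀ k → IGammaBoundIn A k → ∣ A ∣ ≤ k + D

  GapAtMost-remove-dominating : ∀ {e} → y ∈ A → x ∈ A → Adj G y x → DominatedBy A y x →
                                GapAtMost A (suc e) → GapAtMost (A - x) e
  GapAtMost-remove-dominating {e = e} y∈A x∈A yx y≼x gap k bound =
    ≤-pred (subst₂ _≤_ (x∈p⇒∣p∣≡1+∣p-x∣ x∈A) (+-suc k e)
                      (gap k (IGammaBoundIn-remove-dominating y∈A yx y≼x bound)))

  GapAtMost⇒∣nbhd∣≤ : ∀ {D} → x ∈ A → GapAtMost A D → ∣ nbhd A x ∣ ≤ D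
  GapAtMost⇒∣nbhd∣≤ {x} {A} {D} x∈A gap = +-cancelʳ-≤ ∣ A ─ N ∣ ∣ N ∣ D
    (subst₂ _≤_ (∣p∣≡∣q∣+∣p─q∣ A N (p∩q⊆p _ _)) (+-comm ∣ A ─ N ∣ D)
                (gap _ (IGammaBoundIn-nonNeighbours x∈A)))
    where N = nbhd A x

  GapAtMost-closedNeighbourhood : ∀ {D} → x ∈ A → GapAtMost A D →
                                  GapAtMost (A - x ─ nbhd A x) (D ∸ ∣ nbhd A x ∣)
  GapAtMost-closedNeighbourhood {x} {A} {D} x∈A gap k bound =
    subst₂ _≤_ (m+n∸m≡n ∣ N ∣ ∣ A' ∣) (+-∸-assoc k (GapAtMost⇒∣nbhd∣≤ x∈A gap))
               (∸-monoˡ-≤ ∣ N ∣ ∣N∣+∣A'∣≤k+D)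
    where
    N = nbhd A x
    A' = A - x ─ N
    ∣A∣≡ : ∣ A ∣ ≡ suc (∣ N ∣ + ∣ A' ∣)
    ∣A∣≡ = trans (x∈p⇒∣p∣≡1+∣p-x∣ x∈A) (cong suc (∣p∣≡∣q∣+∣p─q∣ (A - x) N nbhd⊆-x))
    ∣N∣+∣A'∣≤k+D : ∣ N ∣ + ∣ A' ∣ ≤ k + D
    ∣N∣+∣A'∣≤k+D =
      ≤-pred (subst (_≤ suc k + D) ∣A∣≡ (gap (suc k) (IGammaBoundIn-closedNeighbourhood x∈A bound)))

  -- Induced paths and chordality

  record InducedPath (A : Subset n) (ℓ : ℕ) (π : ℕ → Fin n) : Set where
    field
      ∈A        : ∀ {i} → i < ℓ → π i ∈ A
      injective : ∀ {i j} → i < ℓ → j < ℓ → π i ≡ π j → i ≡ j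
      linked    : ∀ {i} → suc i < ℓ → Adj G (π i) (π (suc i))
      chordless : ∀ {i j} → i < ℓ → j < ℓ → Adj G (π i) (π j) → suc i ≡ j ⊎ suc j ≡ i

  open InducedPath

  private
    variable
      ℓ : ℕ
      π : ℕ → Fin n

  InducedPath-length : InducedPath A ℓ π → ℓ ≤ n
  InducedPath-length {π = π} path = ≮⇒≥ λ n<ℓ →
    let i , j , i<j , pi≡pj = pigeonhole n<ℓ (π ∘ toℕ)
    in <-irrefl (injective path (toℕ<n i) (toℕ<n j) pi≡pj) i<j

  InducedPath-prefix : ∀ {m} → m ≤ ℓ → InducedPath A ℓ π → InducedPath A m π
  InducedPath-prefix m≤ℓ path = record
    { ∈A        = λ i<m → ∈A path (<-≤-trans i<m m≤ℓ)
    ; injective = λ i<m j<m → injective path (<-≤-trans i<m m≤ℓ) (<-≤-trans j<m m≤ℓ)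
    ; linked    = λ i+1<m → linked path (<-≤-trans i+1<m m≤ℓ)
    ; chordless = λ i<m j<m → chordless path (<-≤-trans i<m m≤ℓ) (<-≤-trans j<m m≤ℓ)
    }

  single-path : v ∈ A → InducedPath A 1 (λ _ → v)
  single-path v∈A = record
    { ∈A        = λ _ → v∈A
    ; injective = λ { (s≤s z≤n) (s≤s z≤n) _ → refl }
    ; linked    = λ { (s≤s ()) }
    ; chordless = λ _ _ vv → contradiction vv Adj-irrefl
    }

  ◂-injective : (∀ {i j} → i < ℓ → j < ℓ → π i ≡ π j → i ≡ j) → (∀ {k} → k < ℓ → z ≢ π k) →
                ∀ {i j} → i < suc ℓ → j < suc ℓ → (z ◂ π) i ≡ (z ◂ π) j → i ≡ j
  ◂-injective inj z∉p {i = zero} {j = zero} _ _ _ = refl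
  ◂-injective inj z∉p {i = zero} {j = suc j} _ (s≤s j<ℓ) z≡pj = contradiction z≡pj (z∉p j<ℓ)
  ◂-injective inj z∉p {i = suc i} {j = zero} (s≤s i<ℓ) _ pi≡z = contradiction (sym pi≡z) (z∉p i<ℓ)
  ◂-injective inj z∉p {i = suc i} {j = suc j} (s≤s i<ℓ) (s≤s j<ℓ) pi≡pj = cong suc (inj i<ℓ j<ℓ pi≡pj)

  ◂-path : InducedPath A ℓ π → z ∈ A → (∀ {k} → k < ℓ → z ≢ π k) →
           (∀ {k} → k < ℓ → Adj G z (π k) → k ≡ 0) → Adj G z (π 0) → InducedPath A (suc ℓ) (z ◂ π)
  ◂-path {ℓ = ℓ} {π = π} {z = z} path z∈A z∉p zadj zp0 = record
    { ∈A        = λ { {zero} _ → z∈A ; {suc i} (s≤s i<ℓ) → ∈A path i<ℓ }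
    ; injective = ◂-injective (injective path) z∉p
    ; linked    = λ { {zero} _ → zp0 ; {suc i} (s≤s i+1<ℓ) → linked path i+1<ℓ }
    ; chordless = chordless′
    }
    where
    chordless′ : ∀ {i j} → i < suc ℓ → j < suc ℓ → Adj G ((z ◂ π) i) ((z ◂ π) j) → suc i ≡ j ⊎ suc j ≡ i
    chordless′ {zero} {zero} _ _ zz = contradiction zz Adj-irrefl
    chordless′ {zero} {suc j} _ (s≤s j<ℓ) zpj = inj₁ (cong suc (sym (zadj j<ℓ zpj)))
    chordless′ {suc i} {zero} (s≤s i<ℓ) _ piz = inj₂ (cong suc (sym (zadj i<ℓ (Adj-sym piz))))
    chordless′ {suc i} {suc j} (s≤s i<ℓ) (s≤s j<ℓ) pipj =
      map (cong suc) (cong suc) (chordless path i<ℓ j<ℓ pipj)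

  ◂-cycle : ∀ {j} → InducedPath A (suc j) π → (∀ {k} → k < suc j → z ≢ π k) →
            (∀ {k} → k < suc j → Adj G z (π k) ⇔ (k ≡ 0 ⊎ k ≡ j)) →
            InducedCycle G (suc (suc j)) (λ i → (z ◂ π) (toℕ i))
  ◂-cycle {π = π} {z = z} {j = j} path z∉π zadj =
    (λ {i} {i'} eq → toℕ-injective (◂-injective (injective path) z∉π (toℕ<n i) (toℕ<n i') eq)) ,
    λ i i' → adjacent⇔ (toℕ<n i) (toℕ<n i')
    where
    Cyc : ℕ → ℕ → Set
    Cyc a b = (suc a ≡ b) ⊎ (suc b ≡ a) ⊎ ((a ≡ 0) × (suc b ≡ suc (suc j))) ⊎ ((b ≡ 0) × (suc a ≡ suc (suc j)))

    Cyc-sym : ∀ {a b} → Cyc a b → Cyc b a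
    Cyc-sym (inj₁ e) = inj₂ (inj₁ e)
    Cyc-sym (inj₂ (inj₁ e)) = inj₁ e
    Cyc-sym (inj₂ (inj₂ (inj₁ e))) = inj₂ (inj₂ (inj₂ e))
    Cyc-sym (inj₂ (inj₂ (inj₂ e))) = inj₂ (inj₂ (inj₁ e))

    z-adjacent⇔ : ∀ {b} → b < suc j → Adj G z (π b) ⇔ Cyc 0 (suc b)
    z-adjacent⇔ b<1+j = mk⇔ to′ from′
      where
      to′ : Adj G z (π _) → Cyc 0 (suc _)
      to′ zπb with Equivalence.to (zadj b<1+j) zπb
      ... | inj₁ refl = inj₁ refl
      ... | inj₂ refl = inj₂ (inj₂ (inj₁ (refl , refl)))
      from′ : Cyc 0 (suc _) → Adj G z (π _)
      from′ (inj₁ refl) = Equivalence.from (zadj b<1+j) (inj₁ refl)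
      from′ (inj₂ (inj₂ (inj₁ (_ , refl)))) = Equivalence.from (zadj b<1+j) (inj₂ refl)

    adjacent⇔ : ∀ {a b} → a < suc (suc j) → b < suc (suc j) → Adj G ((z ◂ π) a) ((z ◂ π) b) ⇔ Cyc a b
    adjacent⇔ {zero} {zero} _ _ = mk⇔ (λ zz → contradiction zz Adj-irrefl) λ { (inj₂ (inj₂ (inj₁ (_ , ())))) }
    adjacent⇔ {zero} {suc b} _ (s≤s b<1+j) = z-adjacent⇔ b<1+j
    adjacent⇔ {suc a} {zero} (s≤s a<1+j) _ =
      mk⇔ (Cyc-sym ∘ Equivalence.to (z-adjacent⇔ a<1+j) ∘ Adj-sym)
          (Adj-sym ∘ Equivalence.from (z-adjacent⇔ a<1+j) ∘ Cyc-sym)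
    adjacent⇔ {suc a} {suc b} (s≤s a<1+j) (s≤s b<1+j) =
      mk⇔ ([ inj₁ ∘ cong suc , inj₂ ∘ inj₁ ∘ cong suc ] ∘ chordless path a<1+j b<1+j) from′
      where
      from′ : Cyc (suc a) (suc b) → Adj G (π a) (π b)
      from′ (inj₁ refl) = linked path b<1+j
      from′ (inj₂ (inj₁ refl)) = Adj-sym (linked path a<1+j)
      from′ (inj₂ (inj₂ (inj₁ (() , _))))
      from′ (inj₂ (inj₂ (inj₂ (() , _))))

  off-path : InducedPath A ℓ π → Adj G z (π 0) → z ≢ π 1 → ∀ {k} → k < ℓ → z ≢ π k
  off-path path zπ0 z≢π1 {k = zero} _ = Adj⇒≢ zπ0
  off-path path zπ0 z≢π1 {k = suc zero} _ = z≢π1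
  off-path {π = π} path zπ0 z≢π1 {k = suc (suc k)} k< z≡π
    with chordless path k< (≤-trans (s≤s z≤n) k<) (subst (λ w → Adj G w (π 0)) z≡π zπ0)
  ... | inj₁ ()
  ... | inj₂ ()

  PrivateNeighbour : Subset n → Fin n → Fin n → Fin n → Set
  PrivateNeighbour A y x z = z ∈ A × Adj G y z × z ≢ x × ¬ Adj G x z

  module _ {A : Subset n} (chordal : Chordal G)
           (private-nb : ∀ {y x} → y ∈ A → x ∈ A → Adj G y x → ∃ (PrivateNeighbour A y x)) where

    -- Prolong π at π 0 by a private neighbour z of π 0 with respect to π 1, unless
    -- z has a further neighbour on π: then the first one closes an induced cycle.
    extend : InducedPath A (suc (suc ℓ)) π → ∃ (InducedPath A (suc (suc (suc ℓ))))
    extend {ℓ} {π} path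
      with private-nb (∈A path (s≤s z≤n)) (∈A path (s≤s (s≤s z≤n))) (linked path (s≤s (s≤s z≤n)))
    ... | z , z∈A , π0z , z≢π1 , ¬π1z
      with firstBelow (λ k → 2 ≤ k × Adj G z (π k)) (λ k → 2 ≤? k ×-dec adj? z (π k)) (suc (suc ℓ))
    ...   | inj₁ none = _ , ◂-path path z∈A (off-path path (Adj-sym π0z) z≢π1) zadj (Adj-sym π0z)
      where
      zadj : ∀ {k} → k < suc (suc ℓ) → Adj G z (π k) → k ≡ 0
      zadj {zero} _ _ = refl
      zadj {suc zero} _ zπ1 = contradiction (Adj-sym zπ1) ¬π1z
      zadj {suc (suc k)} k< zπk = contradiction (s≤s (s≤s z≤n) , zπk) (none k<)
    ...   | inj₂ (j , j<ℓ , (2≤j , zπj) , before) =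
      contradiction
        (◂-cycle (InducedPath-prefix j<ℓ path) (off-path path (Adj-sym π0z) z≢π1 ∘ λ k< → <-≤-trans k< j<ℓ) zadj)
        (chordal (suc (suc j)) (s≤s (s≤s 2≤j)) _)
      where
      zadj : ∀ {k} → k < suc j → Adj G z (π k) ⇔ (k ≡ 0 ⊎ k ≡ j)
      zadj k<1+j = mk⇔ (to′ k<1+j) λ { (inj₁ refl) → Adj-sym π0z ; (inj₂ refl) → zπj }
        where
        to′ : ∀ {k} → k < suc j → Adj G z (π k) → k ≡ 0 ⊎ k ≡ j
        to′ {zero} _ _ = inj₁ refl
        to′ {suc zero} _ zπ1 = contradiction (Adj-sym zπ1) ¬π1z
        to′ {suc (suc k)} k<1+j zπk with m<1+n⇒m<n∨m≡n k<1+j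
        ... | inj₁ k<j = contradiction (s≤s (s≤s z≤n) , zπk) (before k<j)
        ... | inj₂ refl = inj₂ refl

    long-path : HasEdge A → ∀ ℓ → ∃ (InducedPath A (suc (suc ℓ)))
    long-path (u , v , u∈A , v∈A , uv) zero =
      _ , ◂-path (single-path v∈A) u∈A (λ { (s≤s z≤n) → Adj⇒≢ uv }) (λ { (s≤s z≤n) _ → refl }) uv
    long-path edge (suc ℓ) = extend (proj₂ (long-path edge ℓ))

    edgeless : ¬ HasEdge A
    edgeless edge = 1+n≰n (≤-trans (n≤1+n _) (InducedPath-length (proj₂ (long-path edge n))))

  dominatedBy? : ∀ A y x → Dec (DominatedBy A y x)
  dominatedBy? A y x = all? λ z → z ∈? A →-dec (adj? y z →-dec (z ≟ x ⊎-dec adj? x z))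

  ¬dominatedBy⇒privateNeighbour : ∀ {A y x} → ¬ DominatedBy A y x → ∃ (PrivateNeighbour A y x)
  ¬dominatedBy⇒privateNeighbour {A} {y} {x} ¬dom
    with ¬∀⟶∃¬ n _ (λ z → z ∈? A →-dec (adj? y z →-dec (z ≟ x ⊎-dec adj? x z))) ¬dom
  ... | z , ¬dom-z with z ∈? A | adj? y z
  ...   | no z∉A | _ = contradiction (λ z∈A → contradiction z∈A z∉A) ¬dom-z
  ...   | yes _ | no ¬yz = contradiction (λ _ yz → contradiction yz ¬yz) ¬dom-z
  ...   | yes z∈A | yes yz =
    z , z∈A , yz , (λ z≡x → ¬dom-z λ _ _ → inj₁ z≡x) , (λ xz → ¬dom-z λ _ _ → inj₂ xz)

  dominatedEdge : Chordal G → HasEdge A → ∃₂ λ y x → y ∈ A × x ∈ A × Adj G y x × DominatedBy A y x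
  dominatedEdge {A} chordal edge
    with any? (λ y → any? λ x → y ∈? A ×-dec x ∈? A ×-dec adj? y x ×-dec dominatedBy? A y x)
  ... | yes found = found
  ... | no none = contradiction edge (edgeless chordal λ y∈A x∈A yx →
    ¬dominatedBy⇒privateNeighbour λ dom → none (_ , _ , y∈A , x∈A , yx , dom))

  -- Collapsing NC(G[A])

  NC-void : ¬ HasEdge A → ∀ τ → ¬ NC[ A , ⊥ ] τ
  NC-void _ τ (_ , inj₁ (_ , s∈⊥─τ)) = ∉⊥ (p─q⊆p ⊥ τ s∈⊥─τ)
  NC-void ¬edge τ (_ , inj₂ edge) = ¬edge (HasEdge-mono (p─q⊆p _ τ) edge)

  NC-collapsibleBelow-dominatedEdge : ∀ {D} → y ∈ A → x ∈ A → Adj G y x → DominatedBy A y x →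
    GapAtMost A D → (∀ {B D'} → ∣ B ∣ < ∣ A ∣ → GapAtMost B D' → CollapsibleBelow D' NC[ B , ⊥ ]) →
    CollapsibleBelow D NC[ A , ⊥ ]
  NC-collapsibleBelow-dominatedEdge {y} {A} {x} {zero} y∈A x∈A yx y≼x gap _ =
    contradiction (≤-trans (x∈p⇒∣p-x∣<∣p∣ (∈nbhd⁺ y∈A (Adj-sym yx))) (GapAtMost⇒∣nbhd∣≤ x∈A gap)) λ ()
  NC-collapsibleBelow-dominatedEdge {y} {A} {x} {suc e} y∈A x∈A yx y≼x gap smaller⇒collapsible =
    collapsibleBelow-vertexDecomposition NC[ A , ⊥ ] x
      (smaller⇒collapsible (x∈p⇒∣p-x∣<∣p∣ x∈A) (GapAtMost-remove-dominating y∈A x∈A yx y≼x gap))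
      (subst (λ S → link NC[ A , ⊥ ] x ≐ NC[ A - x , S ]) (⊥─p≡⊥ ⁅ x ⁆) (link-NC x∈A))
      (CollapsibleBelow-resp-≐ (≐-sym (deletion-NC-⊥ x∈A))
        (subst (λ d → CollapsibleBelow d NC[ A - x , nbhd A x ]) (m+[n∸m]≡n (GapAtMost⇒∣nbhd∣≤ x∈A gap))
          (NC-peel nbhd⊆-x
            (smaller⇒collapsible (≤-<-trans (∣p─q∣≤∣p∣ (A - x) (nbhd A x)) (x∈p⇒∣p-x∣<∣p∣ x∈A))
                                 (GapAtMost-closedNeighbourhood x∈A gap)))))

  NC-collapsibleBelow : Chordal G → ∀ A {D} → GapAtMost A D → CollapsibleBelow D NC[ A , ⊥ ]
  NC-collapsibleBelow chordal A = go (<-wellFounded ∣ A ∣)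
    where
    go : ∀ {A D} → Acc _<_ ∣ A ∣ → GapAtMost A D → CollapsibleBelow D NC[ A , ⊥ ]
    go {A} (acc smaller) gap with hasEdge? A
    ... | no ¬edge = done (NC-void ¬edge)
    ... | yes edge =
      let y , x , y∈A , x∈A , yx , y≼x = dominatedEdge chordal edge
      in NC-collapsibleBelow-dominatedEdge y∈A x∈A yx y≼x gap λ ∣B∣<∣A∣ → go (smaller ∣B∣<∣A∣)

  NC≐NC[⊤,⊥] : NC G ≐ NC[ ⊤ , ⊥ ]
  NC≐NC[⊤,⊥] = to , from
    where
    to : ∀ {τ} → NC G τ → NC[ ⊤ , ⊥ ] τ
    to {τ} nc with hasEdge? (⊤ ─ τ)
    ... | yes edge = ⊆⊤ , inj₂ edge
    ... | no ¬edge = contradiction (λ u v u∈ v∈ uv → ¬edge (u , v , ⊤─τ u∈ , ⊤─τ v∈ , uv)) nc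
      where
      ⊤─τ : u ∈ ∁ τ → u ∈ ⊤ ─ τ
      ⊤─τ u∈ = x∈p∧x∉q⇒x∈p─q ∈⊤ (x∈∁p⇒x∉p u∈)
    from : ∀ {τ} → NC[ ⊤ , ⊥ ] τ → NC G τ
    from {τ} (_ , inj₁ (_ , s∈⊥─τ)) = contradiction (p─q⊆p ⊥ τ s∈⊥─τ) ∉⊥
    from (_ , inj₂ (u , v , u∈ , v∈ , uv)) cover =
      cover u v (x∉p⇒x∈∁p (x∈p─q⇒x∉q u∈)) (x∉p⇒x∈∁p (x∈p─q⇒x∉q v∈)) uv

  minimal⇒GapAtMost : ∀ {k} → (∀ j → IGammaBound G j → k ≤ j) → GapAtMost ⊤ (n ∸ k)
  minimal⇒GapAtMost {k} minimal j bound =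
    subst (_≤ j + (n ∸ k)) (sym (∣⊤∣≡n n))
      (≤-trans (m≤n+m∸n n k) (+-monoˡ-≤ (n ∸ k) (minimal j globalBound)))
    where
    globalBound : IGammaBound G j
    globalBound I indI = let W , _ , ∣W∣≤j , dom = bound I ⊆⊤ indI in W , ∣W∣≤j , dom

theorem1p3 : (n : ℕ) (G : Graph n) → Chordal G → NoIsolatedVertices G →
    (k : ℕ) → IsIndepDomNumber G k → Collapsible (n ∸ k ∸ 1) (NC G)
theorem1p3 n G chordal _ k (_ , minimal) =
  collapsibleBelow⇒collapsible
    (CollapsibleBelow-resp-≐ (≐-sym (NC≐NC[⊤,⊥] G))
      (NC-collapsibleBelow G chordal ⊤ (minimal⇒GapAtMost G minimal)))
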